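{- Let $A\subset\mathbf{Z}\setminus\{0\}$ be a set of $N$ integers and let $Q_1$ be a parameter. Then there exist $r\in\prod_{p\leqslant Q_1}(\mathbf{Z}/p\mathbf{Z})^\times$ and $(\nu_p)_{p\leqslant Q_1}\in\mathbf{N}^{\pi(Q_1)}$ such that $$|A(r,(\nu_p))|\geqslant\frac{N}{(\dim(A))^{\pi(Q_1)}\prod_{p\leqslant Q_1}p}.$$
   Context: Here $p$ ranges over primes, $\pi(Q_1)$ is the number of primes $\leqslant Q_1$, and $0\in\mathbf{N}$. An element $r\in\prod_{p\leqslant Q_1}(\mathbf{Z}/p\mathbf{Z})^\times$ is identified via the Chinese remainder theorem with a residue class modulo $\prod_{p\leqslant Q_1}p$ coprime to each such $p$; $A(r,(\nu_p))=\{a\in A:a\equiv r\prod_{p\leqslant Q_1}p^{\nu_p}\pmod{\prod_{p\leqslant Q_1}p^{\nu_p+1}}\}$. A set $D$ is dissociated if $\sum_{d\in D}\varepsilon_dd=0$ with $\varepsilon_d\in\{ -1,0,1\}$ implies all $\varepsilon_d=0$; $\dim(A)$ is the size of the largest dissociated subset of $A$. -}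

module Defs where

open import Data.Nat as ℕ using (ℕ; suc; _^_)
open import Data.Nat.Divisibility as ℕD using (_∣?_)
open import Data.Nat.Primality using (prime?)
open import Data.Integer as ℤ using (ℤ; +_; 0ℤ; ∣_∣)
open import Data.Integer.Divisibility using () renaming (_∣_ to _∣ℤ_)
open import Data.List using (List; []; _∷_; length; filter; upTo; map; zipWith; foldr)
open import Data.Nat.ListAction using (product)
open import Data.List.Relation.Unary.All using (All)
open import Data.List.Relation.Unary.Unique.Propositional using (Unique)
open import Data.List.Membership.Propositional using (_∈_)
open import Data.Product using (Σ; _×_)
open import Relation.Binary.PropositionalEquality using (_≡_)
open import Relation.Nullary using (¬_)

-- The list of primes p with p ≤ Q (in increasing order); π(Q) is its length.
primesUpTo : ℕ → List ℕ
primesUpTo Q = filter prime? (upTo (suc Q))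

data Sgn : Set where
  neg zer pos : Sgn

applySgn : Sgn → ℤ → ℤ
applySgn neg x = ℤ.- x
applySgn zer x = 0ℤ
applySgn pos x = x

signedSum : List Sgn → List ℤ → ℤ
signedSum ε D = foldr ℤ._+_ 0ℤ (zipWith applySgn ε D)

Dissociated : List ℤ → Set
Dissociated D = Unique D ×
  ((ε : List Sgn) → length ε ≡ length D → signedSum ε D ≡ 0ℤ → All (_≡ zer) ε)

DissociatedSubset : List ℤ → List ℤ → Set
DissociatedSubset D A = Dissociated D × All (_∈ A) D

IsDim : List ℤ → ℕ → Set
IsDim A d = Σ (List ℤ) (λ D → DissociatedSubset D A × length D ≡ d)
          × ((D : List ℤ) → DissociatedSubset D A → length D ℕ.≤ d)

primePow : ℕ → (ℕ → ℕ) → ℕ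
primePow Q ν = product (map (λ p → p ^ ν p) (primesUpTo Q))

primePowSuc : ℕ → (ℕ → ℕ) → ℕ
primePowSuc Q ν = product (map (λ p → p ^ suc (ν p)) (primesUpTo Q))

-- r is a unit modulo every prime p ≤ Q (r represents an element of ∏_{p≤Q} (Z/pZ)^×).
UnitResidue : ℕ → ℤ → Set
UnitResidue Q r = All (λ p → ¬ ((+ p) ∣ℤ r)) (primesUpTo Q)

Aclass : ℕ → List ℤ → ℤ → (ℕ → ℕ) → List ℤ
Aclass Q A r ν =
  filter (λ a → primePowSuc Q ν ∣? ∣ a ℤ.- r ℤ.* (+ primePow Q ν) ∣) A

{-# OPTIONS --safe #-}
-- For a prime p, a list of nonzero integers with strictly increasing p-adic valuations is
-- dissociated: in a vanishing signed sum, the summand of least valuation v is the only one not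
-- divisible by p ^ (v + 1).  So the elements of A take at most dim(A) valuations at p, and some
-- valuation class keeps a 1/dim(A) share.  Refining at every prime p ≤ Q₁ gives exponents ν and
-- C ⊆ A with |A| ≤ dim(A)^π(Q₁) |C| and v_p(a) = ν_p on C.  Each a ∈ C is then r·M modulo P·M,
-- where M = ∏ p^ν_p, P = ∏ p and r < P is a unit modulo every p ≤ Q₁; pigeonholing over r costs
-- a further factor P.
module Submission where

open import Defs
open import Level using (0ℓ)
open import Function using (_∘_; _on_)
open import Data.Product using (Σ; ∃; ∃₂; _×_; _,_; proj₁; proj₂)
open import Data.Sum using (inj₁; inj₂; [_,_]′)
open import Relation.Nullary using (¬_; Dec; yes; no; ¬?; contradiction)
open import Relation.Unary using (Pred; Decidable)
open import Relation.Binary.PropositionalEquality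
  using (_≡_; _≢_; refl; sym; trans; cong; subst; subst₂; module ≡-Reasoning)
import Algebra.Properties.CommutativeSemigroup as CommutativeSemigroupProperties
import Algebra.Properties.AbelianGroup as AbelianGroupProperties

open import Data.Nat as ℕ
  using (ℕ; zero; suc; _+_; _*_; _^_; _<_; _≤_; _≟_; _<?_; _/_; _%_; z≤n; s≤s; NonZero)
open import Data.Nat.Properties as ℕ
  using (≤-refl; ≤-trans; ≤-reflexive; <-irrefl; *-comm; *-assoc; *-identityˡ; *-monoˡ-≤; *-monoʳ-≤; +-mono-≤; ≤-total)
import Data.Nat.DivMod as ℕ
open import Data.Nat.Divisibility as ℕ
  using (_∣_; _∤_; divides; _∣?_; 1∣_; ∣-trans; m∣m*n; *-monoʳ-∣; *-monoˡ-∣; *-cancelˡ-∣; *-cancelʳ-∣)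
open import Data.Nat.Primality
  using (Prime; prime?; productOfPrimes≢0; prime⇒nonTrivial; prime⇒nonZero; prime⇒irreducible; euclidsLemma; ¬prime[1])
open import Data.Nat.ListAction using (product)
open import Data.Nat.ListAction.Properties using (∈⇒∣product; product≢0)
open import Data.Nat.Tactic.RingSolver using (solve-∀)

open import Data.Integer as ℤ using (ℤ; +_; 0ℤ; ∣_∣)
import Data.Integer.Properties as ℤ
import Data.Integer.Divisibility.Signed as ℤ
open import Data.Integer.DivMod using (_/ℕ_; _%ℕ_; n%ℕd<d; a≡a%ℕn+[a/ℕn]*n)

open import Data.List using (List; []; _∷_; length; filter; map; upTo; _++_; [_])
import Data.List.Properties as List
open import Data.List.Extrema.Nat using (max; xs≤max)
open import Data.List.Relation.Unary.All as All using (All; []; _∷_)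
import Data.List.Relation.Unary.All.Properties as All
open import Data.List.Relation.Unary.Any using (Any; here; there; any?)
import Data.List.Relation.Unary.Any.Properties as Any
open import Data.List.Relation.Unary.AllPairs as AllPairs using (AllPairs; []; _∷_)
import Data.List.Relation.Unary.AllPairs.Properties as AllPairs
open import Data.List.Relation.Unary.Unique.Propositional using (Unique)
import Data.List.Relation.Unary.Unique.Propositional.Properties as Unique
open import Data.List.Membership.Propositional using (_∈_; find; lose)
open import Data.List.Membership.Propositional.Properties using (∈-filter⁺; ∈-filter⁻; ∈-map⁺; ∈-upTo⁺)
open import Data.List.Relation.Binary.Sublist.Propositional using (_⊆_; ⊆-refl; ⊆-trans)
import Data.List.Relation.Binary.Sublist.Propositional.Properties as Sublist

valuation′ : (p fuel n : ℕ) → ℕ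
valuation′ p zero    n = 0
valuation′ p (suc f) n with p ∣? n
... | yes (divides q _) = suc (valuation′ p f q)
... | no  _             = 0

-- The exponent of p in n when 1 < p and n ≢ 0 (fuel n suffices: each step divides n by p);
-- junk otherwise, e.g. valuation p 0 ≡ 0.
valuation : ℕ → ℕ → ℕ
valuation p n = valuation′ p n n

valuationℤ : ℕ → ℤ → ℕ
valuationℤ p a = valuation p ∣ a ∣

pow-valuation′-∣ : ∀ p f n → p ^ valuation′ p f n ∣ n
pow-valuation′-∣ p zero    n = 1∣ n
pow-valuation′-∣ p (suc f) n with p ∣? n
... | yes (divides q refl) = subst (p ^ suc (valuation′ p f q) ∣_) (*-comm p q) (*-monoʳ-∣ p (pow-valuation′-∣ p f q))
... | no  _                = 1∣ n

pow-suc-valuation′-∤ : ∀ {p} → 1 < p → ∀ f n → n ≢ 0 → n ≤ f → p ^ suc (valuation′ p f n) ∤ n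
pow-suc-valuation′-∤ p>1 zero n n≢0 n≤0 _ = n≢0 (ℕ.n≤0⇒n≡0 n≤0)
pow-suc-valuation′-∤ {p} p>1 (suc f) n n≢0 n≤1+f p^[1+v]∣n with p ∣? n
... | no  p∤n = p∤n (∣-trans (m∣m*n 1) p^[1+v]∣n)
... | yes (divides q refl) =
  pow-suc-valuation′-∤ p>1 f q q≢0 q≤f
    (*-cancelʳ-∣ p {{p≢0}} (subst (_∣ q * p) (*-comm p _) p^[1+v]∣n))
  where
  p≢0 : NonZero p
  p≢0 = ℕ.>-nonZero (ℕ.<-trans (s≤s z≤n) p>1)
  q≢0 : q ≢ 0
  q≢0 refl = n≢0 refl
  q≤f : q ≤ f
  q≤f = ℕ.≤-pred (ℕ.<-≤-trans (ℕ.m<m*n q p {{ℕ.≢-nonZero q≢0}} p>1) n≤1+f)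

pow-valuation-∣ : ∀ p n → p ^ valuation p n ∣ n
pow-valuation-∣ p n = pow-valuation′-∣ p n n

pow-suc-valuation-∤ : ∀ {p} → 1 < p → ∀ {n} → n ≢ 0 → p ^ suc (valuation p n) ∤ n
pow-suc-valuation-∤ p>1 {n} n≢0 = pow-suc-valuation′-∤ p>1 n n n≢0 ≤-refl

pow-valuationℤ-∣ : ∀ p a → + (p ^ valuationℤ p a) ℤ.∣ a
pow-valuationℤ-∣ p a = ℤ.∣ᵤ⇒∣ (pow-valuation-∣ p ∣ a ∣)

pow-suc-valuationℤ-∤ : ∀ {p} → 1 < p → ∀ {a} → a ≢ 0ℤ → ¬ + (p ^ suc (valuationℤ p a)) ℤ.∣ a
pow-suc-valuationℤ-∤ p>1 a≢0 = pow-suc-valuation-∤ p>1 (a≢0 ∘ ℤ.∣i∣≡0⇒i≡0) ∘ ℤ.∣⇒∣ᵤ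

^-monoʳ-∣ : ∀ p {m n} → m ≤ n → p ^ m ∣ p ^ n
^-monoʳ-∣ p {n = n} z≤n = 1∣ (p ^ n)
^-monoʳ-∣ p (s≤s m≤n)   = *-monoʳ-∣ p (^-monoʳ-∣ p m≤n)

∣applySgn : ∀ {k x} e → k ℤ.∣ x → k ℤ.∣ applySgn e x
∣applySgn neg k∣x = ℤ.∣m⇒∣-m k∣x
∣applySgn zer _   = ℤ.divides 0ℤ refl
∣applySgn pos k∣x = k∣x

∣signedSum : ∀ {k} ε D → All (k ℤ.∣_) D → k ℤ.∣ signedSum ε D
∣signedSum []      _       _            = ℤ.divides 0ℤ refl
∣signedSum (_ ∷ _) []      _            = ℤ.divides 0ℤ refl
∣signedSum (e ∷ ε) (_ ∷ D) (k∣x ∷ k∣D) = ℤ.∣m∣n⇒∣m+n (∣applySgn e k∣x) (∣signedSum ε D k∣D)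

applySgn-∣⇒zer : ∀ {k x} e → ¬ k ℤ.∣ x → k ℤ.∣ applySgn e x → e ≡ zer
applySgn-∣⇒zer {x = x} neg k∤x k∣-x =
  contradiction (subst (_ ℤ.∣_) (ℤ.neg-involutive x) (ℤ.∣m⇒∣-m k∣-x)) k∤x
applySgn-∣⇒zer zer _   _   = refl
applySgn-∣⇒zer pos k∤x k∣x = contradiction k∣x k∤x

increasing-valuations⇒independent :
  ∀ {p} → 1 < p → ∀ D → All (_≢ 0ℤ) D → AllPairs (_<_ on valuationℤ p) D →
  ∀ ε → length ε ≡ length D → signedSum ε D ≡ 0ℤ → All (_≡ zer) ε
increasing-valuations⇒independent p>1 _ _ _ [] _ _ = []
increasing-valuations⇒independent {p} p>1 (x ∷ D) (x≢0 ∷ D≢0) (x<D ∷ D↑) (e ∷ ε) |ε|≡|D| sum≡0 =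
  e≡zer ∷ increasing-valuations⇒independent p>1 D D≢0 D↑ ε (ℕ.suc-injective |ε|≡|D|) rest≡0
  where
  K : ℤ
  K = + (p ^ suc (valuationℤ p x))
  K∣D : All (K ℤ.∣_) D
  K∣D = All.zipWith (λ { {y} (v<w , _) → ℤ.∣-trans (ℤ.∣ᵤ⇒∣ (^-monoʳ-∣ p v<w)) (pow-valuationℤ-∣ p y) })
                    (x<D , D≢0)
  K∣rest : K ℤ.∣ signedSum ε D
  K∣rest = ∣signedSum ε D K∣D
  e≡zer : e ≡ zer
  e≡zer = applySgn-∣⇒zer e (pow-suc-valuationℤ-∤ p>1 x≢0)
    (ℤ.∣m+n∣n⇒∣m (subst (K ℤ.∣_) (sym sum≡0) (ℤ.divides 0ℤ refl)) K∣rest)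
  rest≡0 : signedSum ε D ≡ 0ℤ
  rest≡0 = trans (sym (ℤ.+-identityˡ _)) (subst (λ e → applySgn e x ℤ.+ signedSum ε D ≡ 0ℤ) e≡zer sum≡0)

increasing-valuations⇒dissociated :
  ∀ {p} → 1 < p → ∀ {D} → All (_≢ 0ℤ) D → AllPairs (_<_ on valuationℤ p) D → Dissociated D
increasing-valuations⇒dissociated {p} p>1 {D} D≢0 D↑ =
  AllPairs.map (λ v<w x≡y → <-irrefl (cong (valuationℤ p) x≡y) v<w) D↑ ,
  increasing-valuations⇒independent p>1 D D≢0 D↑

length-filter-+-∁ : ∀ {X : Set} {P : Pred X 0ℓ} (P? : Decidable P) xs →
                    length xs ≡ length (filter P? xs) + length (filter (¬? ∘ P?) xs)
length-filter-+-∁ P? [] = refl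
length-filter-+-∁ P? (x ∷ xs) with P? x
... | yes _ = cong suc (length-filter-+-∁ P? xs)
... | no  _ = trans (cong suc (length-filter-+-∁ P? xs)) (sym (ℕ.+-suc _ _))

⊆-filter⁺ : ∀ {X : Set} {P : Pred X 0ℓ} (P? : Decidable P) {xs ys} → xs ⊆ ys → All P xs → xs ⊆ filter P? ys
⊆-filter⁺ P? {xs} xs⊆ys Pxs =
  subst (_⊆ _) (List.filter-all P? Pxs) (Sublist.filter⁺ P? P? (λ { refl Px → Px }) xs⊆ys)

module _ {X : Set} (key : X → ℕ) where

  keyClass : ℕ → List X → List X
  keyClass k = filter (λ a → key a ≟ k)

  keyClassᶜ : ℕ → List X → List X
  keyClassᶜ k = filter (λ a → ¬? (key a ≟ k))

  record Representatives (B D : List X) : Set where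
    field
      ∈B         : All (_∈ B) D
      increasing : AllPairs (_<_ on key) D
      covers     : All (λ a → Any (λ b → key a ≡ key b) D) B

  representatives-below : ∀ n B → All (λ a → key a < n) B → ∃ (Representatives B)
  representatives-below zero    B keys<0 = [] , record { ∈B = [] ; increasing = [] ; covers = All.map (λ ()) keys<0 }
  representatives-below (suc n) B keys≤n = extend (any? (λ a → key a ≟ n) B)
    where
    below? : Decidable (λ a → key a < n)
    below? a = key a <? n
    IH : ∃ (Representatives (filter below? B))
    IH = representatives-below n (filter below? B) (All.all-filter below? B)
    D₀ : List X
    D₀ = proj₁ IH
    open Representatives (proj₂ IH) renaming (∈B to D₀∈B↓; increasing to D₀↑; covers to D₀-covers)
    D₀∈B : All (_∈ B) D₀
    D₀∈B = All.map (proj₁ ∘ ∈-filter⁻ below? {xs = B}) D₀∈B↓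
    D₀<n : All (λ x → key x < n) D₀
    D₀<n = All.map (proj₂ ∘ ∈-filter⁻ below? {xs = B}) D₀∈B↓
    D₀-covers-below : ∀ {a} → a ∈ B → key a < n → Any (λ b → key a ≡ key b) D₀
    D₀-covers-below a∈B a<n = All.lookup D₀-covers (∈-filter⁺ below? a∈B a<n)
    extend : Dec (Any (λ a → key a ≡ n) B) → ∃ (Representatives B)
    extend (yes top) with b , b∈B , b≡n ← find top = D₀ ++ [ b ] , record
      { ∈B         = All.++⁺ D₀∈B (b∈B ∷ [])
      ; increasing = AllPairs.++⁺ D₀↑ ([] ∷ []) (All.map (λ x<n → subst (_ <_) (sym b≡n) x<n ∷ []) D₀<n)
      ; covers     = All.tabulate λ {a} a∈B → [ Any.++⁺ˡ ∘ D₀-covers-below a∈B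
                                               , (λ a≡n → Any.++⁺ʳ D₀ (here (trans a≡n (sym b≡n)))) ]′
                                               (ℕ.m<1+n⇒m<n∨m≡n (All.lookup keys≤n a∈B))
      }
    extend (no ¬top) = D₀ , record
      { ∈B         = D₀∈B
      ; increasing = D₀↑
      ; covers     = All.tabulate λ {a} a∈B → [ D₀-covers-below a∈B
                                               , (λ a≡n → contradiction (lose a∈B a≡n) ¬top) ]′
                                               (ℕ.m<1+n⇒m<n∨m≡n (All.lookup keys≤n a∈B))
      }

  keyClass-mono : ∀ k {xs ys} → xs ⊆ ys → keyClass k xs ⊆ keyClass k ys
  keyClass-mono k = Sublist.filter⁺ (λ a → key a ≟ k) (λ a → key a ≟ k) (λ { refl eq → eq })

  representatives : ∀ B → ∃ (Representatives B)
  representatives B = representatives-below (suc (max 0 (map key B))) B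
    (All.map s≤s (All.map⁻ (xs≤max 0 (map key B))))

  pigeonhole-step : ∀ k {k′ j} n B →
    length (keyClassᶜ k B) ≤ n * length (keyClass k′ (keyClassᶜ k B)) →
    length (keyClass k B) ≤ length (keyClass j B) → length (keyClass k′ B) ≤ length (keyClass j B) →
    length B ≤ suc n * length (keyClass j B)
  pigeonhole-step k {k′} {j} n B rest≤ k≤j k′≤j = begin
    length B                                             ≡⟨ length-filter-+-∁ (λ a → key a ≟ k) B ⟩
    length (keyClass k B) + length (keyClassᶜ k B)       ≤⟨ +-mono-≤ k≤j rest≤ ⟩
    length (keyClass j B) + n * length (keyClass k′ (keyClassᶜ k B))
      ≤⟨ ℕ.+-monoʳ-≤ (length (keyClass j B)) (*-monoʳ-≤ n k′-rest≤j) ⟩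
    length (keyClass j B) + n * length (keyClass j B)    ∎
    where
    open ℕ.≤-Reasoning
    k′-rest≤j : length (keyClass k′ (keyClassᶜ k B)) ≤ length (keyClass j B)
    k′-rest≤j = ≤-trans (Sublist.length-mono-≤ (keyClass-mono k′ (Sublist.filter-⊆ _ B))) k′≤j

  keyClassᶜ-keys : ∀ {k ks} B → All (λ a → key a ∈ k ∷ ks) B → All (λ a → key a ∈ ks) (keyClassᶜ k B)
  keyClassᶜ-keys {k} B keys∈ =
    All.zipWith (λ { (here eq , ≢k) → contradiction eq ≢k ; (there ∈ks , _) → ∈ks })
                (All.filter⁺ (λ a → ¬? (key a ≟ k)) keys∈ , All.all-filter (λ a → ¬? (key a ≟ k)) B)

  -- k₀ ∈ ks only excludes ks ≡ [], for which B ≡ [] and no k ∈ ks exists.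
  pigeonhole : ∀ {k₀} ks B → k₀ ∈ ks → All (λ a → key a ∈ ks) B →
               ∃ λ k → k ∈ ks × length B ≤ length ks * length (keyClass k B)
  pigeonhole [] B () _
  pigeonhole (k ∷ []) B _ keys≡k = k , here refl , ≤-reflexive (begin
    length B                  ≡⟨ cong length (List.filter-all (λ a → key a ≟ k) keys≡k′) ⟨
    length (keyClass k B)     ≡⟨ *-identityˡ _ ⟨
    1 * length (keyClass k B) ∎)
    where
    open ≡-Reasoning
    keys≡k′ : All (λ a → key a ≡ k) B
    keys≡k′ = All.map (λ { (here eq) → eq }) keys≡k
  pigeonhole (k ∷ ks@(_ ∷ _)) B _ keys∈
    with k′ , k′∈ks , rest≤ ← pigeonhole ks (keyClassᶜ k B) (here refl) (keyClassᶜ-keys B keys∈)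
    with ≤-total (length (keyClass k B)) (length (keyClass k′ B))
  ... | inj₁ k≤k′ = k′ , there k′∈ks , pigeonhole-step k (length ks) B rest≤ k≤k′ ≤-refl
  ... | inj₂ k′≤k = k  , here refl   , pigeonhole-step k (length ks) B rest≤ ≤-refl k′≤k

  large-keyClass : ∀ {d} B → (∀ D → All (_∈ B) D → AllPairs (_<_ on key) D → length D ≤ d) →
                   ∃ λ k → length B ≤ d * length (keyClass k B)
  large-keyClass []          _ = 0 , z≤n
  large-keyClass {d} B@(_ ∷ _) increasing≤d
    with D , record { ∈B = D⊆B ; increasing = D↑ ; covers = covers } ← representatives B
    with k , _ , B≤ ← pigeonhole (map key D) B (Any.map⁺ (All.lookup covers (here refl))) (All.map Any.map⁺ covers)
    = k , (begin
      length B                          ≤⟨ B≤ ⟩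
      length (map key D) * length class ≡⟨ cong (_* length class) (List.length-map key D) ⟩
      length D * length class           ≤⟨ *-monoˡ-≤ (length class) (increasing≤d D D⊆B D↑) ⟩
      d * length class                  ∎)
    where
    open ℕ.≤-Reasoning
    class : List X
    class = keyClass k B

prime≢1 : ∀ {p} → Prime p → p ≢ 1
prime≢1 p-prime refl = ¬prime[1] p-prime

prime⇒1< : ∀ {p} → Prime p → 1 < p
prime⇒1< {p} p-prime = ℕ.nonTrivial⇒n>1 p {{prime⇒nonTrivial p-prime}}

prime∣prime^⇒≡ : ∀ {p q} → Prime p → Prime q → ∀ k → p ∣ q ^ k → p ≡ q
prime∣prime^⇒≡ p-prime _ zero p∣1 = contradiction (ℕ.∣1⇒≡1 p∣1) (prime≢1 p-prime)
prime∣prime^⇒≡ {q = q} p-prime q-prime (suc k) p∣q^[1+k] with euclidsLemma q (q ^ k) p-prime p∣q^[1+k]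
... | inj₂ p∣q^k = prime∣prime^⇒≡ p-prime q-prime k p∣q^k
... | inj₁ p∣q with prime⇒irreducible q-prime p∣q
...   | inj₁ p≡1 = contradiction p≡1 (prime≢1 p-prime)
...   | inj₂ p≡q = p≡q

prime∤product-of-powers : ∀ {p} → Prime p → (e : ℕ → ℕ) → ∀ {qs} → All Prime qs → All (p ≢_) qs →
                          p ∤ product (map (λ q → q ^ e q) qs)
prime∤product-of-powers p-prime e [] [] p∣1 = contradiction (ℕ.∣1⇒≡1 p∣1) (prime≢1 p-prime)
prime∤product-of-powers p-prime e {q ∷ qs} (q-prime ∷ qs-prime) (p≢q ∷ p∉qs) p∣∏
  with euclidsLemma (q ^ e q) (product (map (λ q → q ^ e q) qs)) p-prime p∣∏
... | inj₁ p∣q^e = p≢q (prime∣prime^⇒≡ p-prime q-prime (e q) p∣q^e)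
... | inj₂ p∣∏qs = prime∤product-of-powers p-prime e qs-prime p∉qs p∣∏qs

prime^∣*-cancelʳ : ∀ {p r} → Prime p → p ∤ r → ∀ e {m} → p ^ e ∣ m * r → p ^ e ∣ m
prime^∣*-cancelʳ _ _ zero {m} _ = 1∣ m
prime^∣*-cancelʳ {p} {r} p-prime p∤r (suc e) {m} p^[1+e]∣mr
  with euclidsLemma m r p-prime (∣-trans (m∣m*n (p ^ e)) p^[1+e]∣mr)
... | inj₂ p∣r = contradiction p∣r p∤r
... | inj₁ (divides m′ refl) =
  subst (p ^ suc e ∣_) (*-comm p m′)
    (*-monoʳ-∣ p (prime^∣*-cancelʳ p-prime p∤r e
      (*-cancelˡ-∣ p {{prime⇒nonZero p-prime}} (subst (p ^ suc e ∣_) m′pr≡p[m′r] p^[1+e]∣mr))))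
  where
  m′pr≡p[m′r] : m′ * p * r ≡ p * (m′ * r)
  m′pr≡p[m′r] = trans (cong (_* r) (*-comm m′ p)) (*-assoc p m′ r)

product-of-prime-powers-∣ : ∀ {Ps} → All Prime Ps → Unique Ps → (e : ℕ → ℕ) → ∀ {n} →
                            All (λ p → p ^ e p ∣ n) Ps → product (map (λ p → p ^ e p) Ps) ∣ n
product-of-prime-powers-∣ [] [] e {n} [] = 1∣ n
product-of-prime-powers-∣ {p ∷ Ps} (p-prime ∷ Ps-prime) (p∉Ps ∷ Ps-distinct) e (p^e∣n ∷ Ps^e∣n)
  with product-of-prime-powers-∣ Ps-prime Ps-distinct e Ps^e∣n
... | divides m refl =
  *-monoˡ-∣ R (prime^∣*-cancelʳ p-prime (prime∤product-of-powers p-prime e Ps-prime p∉Ps) (e p) {m} p^e∣n)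
  where
  R : ℕ
  R = product (map (λ p → p ^ e p) Ps)

product-of-pow-suc : ∀ Ps (e : ℕ → ℕ) →
  product (map (λ p → p ^ suc (e p)) Ps) ≡ product Ps * product (map (λ p → p ^ e p) Ps)
product-of-pow-suc []       e = refl
product-of-pow-suc (p ∷ Ps) e = begin
  p * p ^ e p * product (map (λ p → p ^ suc (e p)) Ps)                ≡⟨ cong (p * p ^ e p *_) (product-of-pow-suc Ps e) ⟩
  p * p ^ e p * (product Ps * product (map (λ p → p ^ e p) Ps))       ≡⟨ interchange p (p ^ e p) _ _ ⟩
  p * product Ps * (p ^ e p * product (map (λ p → p ^ e p) Ps))       ∎
  where
  open ≡-Reasoning
  open CommutativeSemigroupProperties ℕ.*-commutativeSemigroup using (interchange)

HasValuations : List ℕ → (ℕ → ℕ) → ℤ → Set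
HasValuations Ps ν a = All (λ p → valuationℤ p a ≡ ν p) Ps

_[_≔_] : (ℕ → ℕ) → ℕ → ℕ → ℕ → ℕ
(ν [ p ≔ k ]) q with q ≟ p
... | yes _ = k
... | no  _ = ν q

≡-[≔] : ∀ (f ν : ℕ → ℕ) {p k} → f p ≡ k → ∀ {q} → (q ≢ p → f q ≡ ν q) → f q ≡ (ν [ p ≔ k ]) q
≡-[≔] f ν {p} fp≡k {q} fq≡νq with q ≟ p
... | yes refl = fp≡k
... | no  q≢p  = fq≡νq q≢p

hasValuations-∷ : ∀ {p Ps ν k a} → valuationℤ p a ≡ k → HasValuations Ps ν a →
                  HasValuations (p ∷ Ps) (ν [ p ≔ k ]) a
hasValuations-∷ {ν = ν} {a = a} vₚ≡k vals =
  ≡-[≔] f ν vₚ≡k (λ p≢p → contradiction refl p≢p) ∷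
  All.map (λ v≡ν → ≡-[≔] f ν vₚ≡k (λ _ → v≡ν)) vals
  where
  f : ℕ → ℕ
  f q = valuationℤ q a

module _ {A : List ℤ} (A≢0 : All (_≢ 0ℤ) A) {d : ℕ}
         (dim≤ : ∀ D → DissociatedSubset D A → length D ≤ d) where

  large-valuationClass : ∀ {p} → Prime p → ∀ {B} → B ⊆ A →
                         ∃ λ k → length B ≤ d * length (keyClass (valuationℤ p) k B)
  large-valuationClass {p} p-prime {B} B⊆A = large-keyClass (valuationℤ p) B λ D D∈B D↑ →
    let D⊆A = All.map (Sublist.Any-resp-⊆ B⊆A) D∈B in
    dim≤ D (increasing-valuations⇒dissociated (prime⇒1< p-prime) (All.map (All.lookup A≢0) D⊆A) D↑ , D⊆A)

  refine-by-valuations : ∀ {Ps} → All Prime Ps → ∀ {B} → B ⊆ A →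
    ∃₂ λ ν C → C ⊆ B × All (HasValuations Ps ν) C × length B ≤ d ^ length Ps * length C
  refine-by-valuations [] {B} _ = (λ _ → 0) , B , ⊆-refl , All.tabulate (λ _ → []) , ≤-reflexive (sym (*-identityˡ _))
  refine-by-valuations {p ∷ Ps} (p-prime ∷ Ps-prime) {B} B⊆A
    with k , B≤ ← large-valuationClass p-prime B⊆A
    with ν , C , C⊆class , C-vals , class≤ ← refine-by-valuations Ps-prime (⊆-trans (Sublist.filter-⊆ _ B) B⊆A)
    = ν [ p ≔ k ] , C , ⊆-trans C⊆class (Sublist.filter-⊆ _ B)
    , All.zipWith (λ {a} (vₚ≡k , vals) → hasValuations-∷ {a = a} vₚ≡k vals)
                  (Sublist.All-resp-⊆ C⊆class (All.all-filter _ B) , C-vals)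
    , (begin
      length B                             ≤⟨ B≤ ⟩
      d * length (keyClass (valuationℤ p) k B) ≤⟨ *-monoʳ-≤ d class≤ ⟩
      d * (d ^ length Ps * length C)       ≡⟨ *-assoc d _ _ ⟨
      d ^ length (p ∷ Ps) * length C       ∎)
    where open ℕ.≤-Reasoning

module Residues {Ps : List ℕ} (Ps-prime : All Prime Ps) (Ps-distinct : Unique Ps) (ν : ℕ → ℕ) where

  M P : ℕ
  M = product (map (λ p → p ^ ν p) Ps)
  P = product Ps

  instance
    M≢0 : NonZero M
    M≢0 = product≢0 (All.map⁺ (All.map (λ {p} p-prime → ℕ.m^n≢0 p (ν p) {{prime⇒nonZero p-prime}}) Ps-prime))
    P≢0 : NonZero P
    P≢0 = productOfPrimes≢0 Ps-prime
    P*M≢0 : NonZero (P * M)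
    P*M≢0 = ℕ.m*n≢0 P M

  residue : ℤ → ℕ
  residue a = (a %ℕ (P * M)) / M

  IsUnit : ℕ → Set
  IsUnit k = All (_∤ k) Ps

  isUnit? : Decidable IsUnit
  isUnit? k = All.all? (λ p → ¬? (p ∣? k)) Ps

  units : List ℕ
  units = filter isUnit? (upTo P)

  length-units≤P : length units ≤ P
  length-units≤P = ≤-trans (List.length-filter _ (upTo P)) (≤-reflexive (List.length-upTo P))

  1%P∈units : 1 % P ∈ units
  1%P∈units = ∈-filter⁺ isUnit? (∈-upTo⁺ (ℕ.m%n<n 1 P)) (All.tabulate λ p∈Ps p∣1%P →
    prime≢1 (All.lookup Ps-prime p∈Ps) (ℕ.∣1⇒≡1 (ℕ.∣n∣m%n⇒∣m (∈⇒∣product p∈Ps) p∣1%P)))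

  module _ {a} (a≢0 : a ≢ 0ℤ) (vals : HasValuations Ps ν a) where

    M∣a : M ∣ ∣ a ∣
    M∣a = product-of-prime-powers-∣ Ps-prime Ps-distinct ν
      (All.map (λ {p} vₚ≡νₚ → subst (λ v → p ^ v ∣ ∣ a ∣) vₚ≡νₚ (pow-valuation-∣ p ∣ a ∣)) vals)

    residue*M≡a%ℕP*M : residue a * M ≡ a %ℕ (P * M)
    residue*M≡a%ℕP*M = ℕ.m/n*n≡m (ℤ.∣⇒∣ᵤ M∣a%ℕP*M)
      where
      M∣a%ℕP*M : + M ℤ.∣ + (a %ℕ (P * M))
      M∣a%ℕP*M = ℤ.∣m+n∣n⇒∣m
        (subst (+ M ℤ.∣_) (a≡a%ℕn+[a/ℕn]*n a (P * M)) (ℤ.∣ᵤ⇒∣ M∣a))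
        (ℤ.∣n⇒∣m*n (a /ℕ (P * M)) (ℤ.∣ᵤ⇒∣ {+ M} {+ (P * M)} (ℕ.n∣m*n P)))

    a≡residue*M+q*P*M : a ≡ + (residue a * M) ℤ.+ (a /ℕ (P * M)) ℤ.* + (P * M)
    a≡residue*M+q*P*M = trans (a≡a%ℕn+[a/ℕn]*n a (P * M))
      (cong (λ r → + r ℤ.+ (a /ℕ (P * M)) ℤ.* + (P * M)) (sym residue*M≡a%ℕP*M))

    residue∈units : residue a ∈ units
    residue∈units = ∈-filter⁺ isUnit? (∈-upTo⁺ (ℕ.m<n*o⇒m/o<n {n = P} (n%ℕd<d a (P * M)))) (All.tabulate p∤residue)
      where
      p∤residue : ∀ {p} → p ∈ Ps → p ∤ residue a
      p∤residue {p} p∈Ps p∣residue = pow-suc-valuationℤ-∤ (prime⇒1< (All.lookup Ps-prime p∈Ps)) a≢0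
        (subst (λ v → + (p ^ suc v) ℤ.∣ a) (sym (All.lookup vals p∈Ps)) p^[1+ν]∣a)
        where
        p^ν∣M : p ^ ν p ∣ M
        p^ν∣M = ∈⇒∣product (∈-map⁺ (λ p → p ^ ν p) p∈Ps)
        p^[1+ν]∣residue*M : p ^ suc (ν p) ∣ residue a * M
        p^[1+ν]∣residue*M = ℕ.*-pres-∣ p∣residue p^ν∣M
        p^[1+ν]∣P*M : p ^ suc (ν p) ∣ P * M
        p^[1+ν]∣P*M = ℕ.*-pres-∣ (∈⇒∣product p∈Ps) p^ν∣M
        p^[1+ν]∣a : + (p ^ suc (ν p)) ℤ.∣ a
        p^[1+ν]∣a = subst (+ (p ^ suc (ν p)) ℤ.∣_) (sym a≡residue*M+q*P*M)
          (ℤ.∣m∣n⇒∣m+n (ℤ.∣ᵤ⇒∣ {i = + (residue a * M)} p^[1+ν]∣residue*M)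
                       (ℤ.∣n⇒∣m*n (a /ℕ (P * M)) (ℤ.∣ᵤ⇒∣ {i = + (P * M)} p^[1+ν]∣P*M)))

    P*M∣a-residue*M : P * M ∣ ∣ a ℤ.- + residue a ℤ.* + M ∣
    P*M∣a-residue*M = ℤ.∣⇒∣ᵤ (ℤ.divides (a /ℕ (P * M)) (begin
      a ℤ.- + residue a ℤ.* + M                     ≡⟨ cong (λ x → a ℤ.- x) (ℤ.pos-* (residue a) M) ⟨
      a ℤ.- + (residue a * M)                       ≡⟨ cong (λ x → x ℤ.- + (residue a * M)) a≡residue*M+q*P*M ⟩
      + (residue a * M) ℤ.+ q ℤ.* + (P * M) ℤ.- + (residue a * M) ≡⟨ xyx⁻¹≈y (+ (residue a * M)) _ ⟩
      q ℤ.* + (P * M)                               ∎))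
      where
      open ≡-Reasoning
      open AbelianGroupProperties ℤ.+-0-abelianGroup using (xyx⁻¹≈y)
      q : ℤ
      q = a /ℕ (P * M)

  -- For Ps = primesUpTo Q, residueClass k A is Aclass Q A (+ k) ν, i.e. A(k, ν) of the paper.
  residueClass : ℕ → List ℤ → List ℤ
  residueClass k = filter (λ a → product (map (λ p → p ^ suc (ν p)) Ps) ∣? ∣ a ℤ.- + k ℤ.* + M ∣)

  large-residueClass : ∀ {A C} → C ⊆ A → All (_≢ 0ℤ) C → All (HasValuations Ps ν) C →
                       ∃ λ k → IsUnit k × length C ≤ P * length (residueClass k A)
  large-residueClass {A} {C} C⊆A C≢0 C-vals = conclude (pigeonhole residue units C 1%P∈units
    (All.zipWith (λ (a≢0 , vals) → residue∈units a≢0 vals) (C≢0 , C-vals)))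
    where
    conclude : (∃ λ k → k ∈ units × length C ≤ length units * length (keyClass residue k C)) →
               ∃ λ k → IsUnit k × length C ≤ P * length (residueClass k A)
    conclude (k , k∈units , C≤) = k , proj₂ (∈-filter⁻ isUnit? {xs = upTo P} k∈units) , (begin
      length C                                     ≤⟨ C≤ ⟩
      length units * length (keyClass residue k C) ≤⟨ ℕ.*-mono-≤ length-units≤P (Sublist.length-mono-≤ class⊆) ⟩
      P * length (residueClass k A)                ∎)
      where
      open ℕ.≤-Reasoning
      in-class : All (λ a → product (map (λ p → p ^ suc (ν p)) Ps) ∣ ∣ a ℤ.- + k ℤ.* + M ∣) (keyClass residue k C)
      in-class = All.zipWith
        (λ { {a} (residue≡k , a≢0 , vals) → subst₂ (λ N r → N ∣ ∣ a ℤ.- + r ℤ.* + M ∣)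
                                              (sym (product-of-pow-suc Ps ν)) residue≡k (P*M∣a-residue*M a≢0 vals) })
        (All.all-filter _ C , Sublist.All-resp-⊆ (Sublist.filter-⊆ _ C) (All.zip (C≢0 , C-vals)))
      class⊆ : keyClass residue k C ⊆ residueClass k A
      class⊆ = ⊆-filter⁺ _ (⊆-trans (Sublist.filter-⊆ _ C) C⊆A) in-class

primesUpTo-prime : ∀ Q → All Prime (primesUpTo Q)
primesUpTo-prime Q = All.all-filter prime? (upTo (suc Q))

primesUpTo-distinct : ∀ Q → Unique (primesUpTo Q)
primesUpTo-distinct Q = Unique.filter⁺ prime? (Unique.upTo⁺ (suc Q))

lemma7p1 : (A : List ℤ) → Unique A → All (_≢ 0ℤ) A → (Q₁ d : ℕ) → IsDim A d →
    Σ ℤ (λ r → Σ (ℕ → ℕ) (λ ν → UnitResidue Q₁ r ×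
      length A ≤ length (Aclass Q₁ A r ν) * (d ^ length (primesUpTo Q₁)) * product (primesUpTo Q₁)))
lemma7p1 A _ A≢0 Q₁ d (_ , dim≤) =
  let ν , C , C⊆A , C-vals , A≤ = refine-by-valuations A≢0 dim≤ (primesUpTo-prime Q₁) ⊆-refl
      k , k-unit , C≤ = Residues.large-residueClass (primesUpTo-prime Q₁) (primesUpTo-distinct Q₁) ν
                          C⊆A (Sublist.All-resp-⊆ C⊆A A≢0) C-vals
      π = length (primesUpTo Q₁)
      P = product (primesUpTo Q₁)
  in + k , ν , k-unit ,
     ≤-trans A≤ (≤-trans (*-monoʳ-≤ (d ^ π) C≤)
                         (≤-reflexive (rearrange (d ^ π) P (length (Aclass Q₁ A (+ k) ν)))))
  where
  rearrange : ∀ x y z → x * (y * z) ≡ z * x * y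
  rearrange = solve-∀
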